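{- Let $q\ge 3$ be odd. If $p\ge 2q+1$, then $G_{q,p}$ contains $P_{3q-3}$ as an induced subgraph.
   Context: All graphs are finite and simple. $P_t$ is the path on $t$ vertices. For odd $q\ge 3$ and $p\ge 1$, $G_{q,p}$ is the graph with vertex set $\{0,1,\dots,qp-3\}$, where arithmetic on vertices is modulo $qp-2$, in which the neighborhood of each vertex $i$ is $N(i)=\{i-1,i+1\}\cup\{i+qj-1 : j\in\{1,\dots,p-1\}\}$. -}

module Defs where

open import Data.Nat using (ℕ; suc; _+_; _*_; _∸_; _≤_; _<_)
open import Data.Product using (Σ; ∃; ∃-syntax; _×_)
open import Data.Sum using (_⊎_)
open import Data.Fin using (Fin; toℕ)
open import Function.Definitions using (Injective)
open import Relation.Binary.PropositionalEquality using (_≡_)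
open import Relation.Nullary using (¬_)

CongMod : ℕ → ℕ → ℕ → Set
CongMod m a b = ∃[ k ] ((a ≡ b + k * m) ⊎ (b ≡ a + k * m))

order : ℕ → ℕ → ℕ
order q p = q * p ∸ 2

Vertex : ℕ → ℕ → Set
Vertex q p = Fin (order q p)

Adj : (q p : ℕ) → Vertex q p → Vertex q p → Set
Adj q p i j =
  CongMod (order q p) (toℕ j + 1) (toℕ i)
  ⊎ CongMod (order q p) (toℕ j) (toℕ i + 1)
  ⊎ (∃[ k ] ((1 ≤ k) × (k ≤ p ∸ 1) × CongMod (order q p) (toℕ j) (toℕ i + q * k ∸ 1)))

Consecutive : ℕ → ℕ → Set
Consecutive a b = (suc a ≡ b) ⊎ (suc b ≡ a)

HasInducedPath : {V : Set} → (V → V → Set) → ℕ → Set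
HasInducedPath {V} E t =
  Σ (Fin t → V) λ f →
    Injective _≡_ _≡_ f
    × (∀ a b → (Consecutive (toℕ a) (toℕ b) → E (f a) (f b))
             × (E (f a) (f b) → Consecutive (toℕ a) (toℕ b)))

{-# OPTIONS --safe #-}
-- Below the wrap-around point qp − 2, adjacency in G_{q,p} is a relation on ℕ: u and v are
-- adjacent iff v + 1 ∈ u + qℕ or u + 1 ∈ v + qℕ. On base-q digits (hi, lo), v + 1 ∈ u + qℕ
-- means either lo u = lo v + 1 and hi u ≤ hi v, or lo u = 0, lo v = q − 1 and hi u ≤ hi v + 1.
-- With Q = q − 2, take the 3q − 3 vertices
--   0, A Q, B Q, C (Q − 1), A (Q − 1), B (Q − 1), …, C 0, A 0, B 0
-- with digits A j = (j + 1, j + 1), B j = (q + j + 1, j), C j = (q + j + 2, j). Consecutive ones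
-- satisfy the digit condition and a case check shows that no other pair does. All of them lie
-- below 2q², and p ≥ 2q + 1 keeps 2q² clear of the wrap-around.
module Submission where

open import Defs
open import Data.Empty using (⊥-elim)
open import Data.Fin using (Fin; toℕ; fromℕ<)
open import Data.Fin.Properties using (toℕ-fromℕ<; toℕ<n; toℕ-injective)
open import Data.List using (_∷_; [])
open import Data.Nat
open import Data.Nat.DivMod using (_%_; [m+kn]%n≡m%n; m<n⇒m%n≡m)
open import Data.Nat.Properties
open import Data.Nat.Tactic.RingSolver using (solve)
open import Data.Product using (∃-syntax; _×_; _,_; proj₁; proj₂)
open import Data.Sum using (_⊎_; inj₁; inj₂; swap)
import Data.Sum as Sum
open import Data.Unit using (⊤; tt)
open import Function using (_∘_)
open import Function.Definitions using (Injective)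
open import Relation.Binary.PropositionalEquality

CongMod-<⇒≡⊎≡+ : ∀ {n a b} → a < n → b < n + n → CongMod n a b → a ≡ b ⊎ b ≡ a + n
CongMod-<⇒≡⊎≡+ {b = b} _ _ (zero , inj₁ a≡b+0) = inj₁ (trans a≡b+0 (+-identityʳ b))
CongMod-<⇒≡⊎≡+ {n} {b = b} a<n _ (suc k , inj₁ a≡) =
  ⊥-elim (<⇒≱ a<n (subst (n ≤_) (sym a≡) (≤-trans (m≤m+n n (k * n)) (m≤n+m _ b))))
CongMod-<⇒≡⊎≡+ {a = a} _ _ (zero , inj₂ b≡a+0) = inj₁ (sym (trans b≡a+0 (+-identityʳ a)))
CongMod-<⇒≡⊎≡+ {n} {a} _ _ (suc zero , inj₂ b≡) = inj₂ (trans b≡ (cong (a +_) (+-identityʳ n)))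
CongMod-<⇒≡⊎≡+ {n} {a} _ b<n+n (suc (suc k) , inj₂ b≡) =
  ⊥-elim (<⇒≱ b<n+n (subst (n + n ≤_) (sym b≡)
    (≤-trans (+-monoʳ-≤ n (m≤m+n n (k * n))) (m≤n+m _ a))))

CongMod-<⇒≡ : ∀ {n a b} → a < n → b < n → CongMod n a b → a ≡ b
CongMod-<⇒≡ {n} {a} a<n b<n c with CongMod-<⇒≡⊎≡+ a<n (≤-trans b<n (m≤m+n n n)) c
... | inj₁ a≡b = a≡b
... | inj₂ b≡a+n = ⊥-elim (<⇒≱ b<n (subst (n ≤_) (sym b≡a+n) (m≤n+m n a)))

digits-injective : ∀ {q a b c d} → b < q → d < q → a * q + b ≡ c * q + d → a ≡ c × b ≡ d
digits-injective {suc q′} {a} {b} {c} {d} b<q d<q eq = a≡c , b≡d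
  where
  open ≡-Reasoning
  q : ℕ
  q = suc q′
  b≡d : b ≡ d
  b≡d = begin
    b                ≡⟨ m<n⇒m%n≡m b<q ⟨
    b % q            ≡⟨ [m+kn]%n≡m%n b a q ⟨
    (b + a * q) % q  ≡⟨ cong (_% q) (trans (+-comm b _) (trans eq (+-comm _ d))) ⟩
    (d + c * q) % q  ≡⟨ [m+kn]%n≡m%n d c q ⟩
    d % q            ≡⟨ m<n⇒m%n≡m d<q ⟩
    d                ∎
  a≡c : a ≡ c
  a≡c = *-cancelʳ-≡ a c q (+-cancelʳ-≡ b _ _ (trans eq (cong (c * q +_) (sym b≡d))))

digits-< : ∀ {q a b c} → b < q → a < c → a * q + b < c * q
digits-< {q} {a} {b} {c} b<q a<c = begin-strict
  a * q + b  <⟨ +-monoʳ-< (a * q) b<q ⟩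
  a * q + q  ≡⟨ +-comm (a * q) q ⟩
  suc a * q  ≤⟨ *-monoˡ-≤ q a<c ⟩
  c * q      ∎
  where open ≤-Reasoning

-- Below the wrap-around these are the edges of G_{q,p}: K = 0 gives v = u − 1 and K ≥ 1 gives
-- v = u + qK − 1.
Jump : ℕ → ℕ → ℕ → Set
Jump q u v = ∃[ K ] (v + 1 ≡ u + K * q)

JumpEdge : ℕ → ℕ → ℕ → Set
JumpEdge q u v = Jump q u v ⊎ Jump q v u

jump-shift : ∀ q a b K → Jump q (a * q + suc b) ((K + a) * q + b)
jump-shift q a b K = K , solve (q ∷ a ∷ b ∷ K ∷ [])

jump-carry : ∀ m → Jump (suc m) 0 (m * suc m + m)
jump-carry m = suc m , solve (m ∷ [])

jump-digits : ∀ {q a b c d} → b < q → d < q → Jump q (a * q + b) (c * q + d) →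
              (b ≡ suc d × a ≤ c) ⊎ (suc d ≡ q × b ≡ 0 × a ≤ suc c)
jump-digits {q} {a} {b} {c} {d} b<q d<q (K , eq) = split-on-carry (m≤n⇒m<n∨m≡n d<q)
  where
  open ≡-Reasoning
  regrouped : c * q + suc d ≡ (a + K) * q + b
  regrouped = begin
    c * q + suc d       ≡⟨ solve (c ∷ q ∷ d ∷ []) ⟩
    c * q + d + 1       ≡⟨ eq ⟩
    a * q + b + K * q   ≡⟨ solve (a ∷ q ∷ b ∷ K ∷ []) ⟩
    (a + K) * q + b     ∎
  a≤ : ∀ {x} → a + K ≡ x → a ≤ x
  a≤ refl = m≤m+n a K
  split-on-carry : suc d < q ⊎ suc d ≡ q → (b ≡ suc d × a ≤ c) ⊎ (suc d ≡ q × b ≡ 0 × a ≤ suc c)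
  split-on-carry (inj₁ 1+d<q) =
    let a+K≡c , b≡1+d = digits-injective b<q 1+d<q (sym regrouped)
    in inj₁ (b≡1+d , a≤ a+K≡c)
  split-on-carry (inj₂ 1+d≡q) =
    let a+K≡1+c , b≡0 = digits-injective b<q (≤-trans (s≤s z≤n) b<q) (sym carried)
    in inj₂ (1+d≡q , b≡0 , a≤ a+K≡1+c)
    where
    carried : suc c * q + 0 ≡ (a + K) * q + b
    carried = begin
      suc c * q + 0  ≡⟨ solve (c ∷ q ∷ []) ⟩
      c * q + q      ≡⟨ cong (c * q +_) 1+d≡q ⟨
      c * q + suc d  ≡⟨ regrouped ⟩
      (a + K) * q + b ∎

-- Adj q p i j unfolds to Adjℕ q p (toℕ i) (toℕ j).
Adjℕ : ℕ → ℕ → ℕ → ℕ → Set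
Adjℕ q p u v =
  CongMod (order q p) (v + 1) u
  ⊎ CongMod (order q p) v (u + 1)
  ⊎ (∃[ k ] ((1 ≤ k) × (k ≤ p ∸ 1) × CongMod (order q p) v (u + q * k ∸ 1)))

module Adjacency (q p : ℕ) (3≤q : 3 ≤ q) (1≤p : 1 ≤ p) where

  n : ℕ
  n = order q p

  n+2≡q*p : n + 2 ≡ q * p
  n+2≡q*p = m∸n+n≡m (≤-trans (n≤1+n 2) (≤-trans 3≤q q≤q*p))
    where
    q≤q*p : q ≤ q * p
    q≤q*p = subst (_≤ q * p) (*-identityʳ q) (*-monoʳ-≤ q 1≤p)

  m+1<n⇒m<n : ∀ {m} → m + 1 < n → m < n
  m+1<n⇒m<n {m} = m+n≤o⇒m≤o (suc m)

  q*k<n : ∀ {k} → k < p → q * k < n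
  q*k<n {k} k<p = +-cancelʳ-≤ 2 _ _ (begin
    suc (q * k) + 2  ≡⟨ +-comm (suc (q * k)) 2 ⟩
    3 + q * k        ≤⟨ +-monoˡ-≤ (q * k) 3≤q ⟩
    q + q * k        ≡⟨ *-suc q k ⟨
    q * suc k        ≤⟨ *-monoʳ-≤ q k<p ⟩
    q * p            ≡⟨ n+2≡q*p ⟨
    n + 2            ∎)
    where open ≤-Reasoning

  wrap-sum : ∀ {v d k} → d + k ≡ p → v + d * q + q * k ≡ v + (n + 2)
  wrap-sum {v} {d} {k} d+k≡p = begin
    v + d * q + q * k  ≡⟨ solve (v ∷ d ∷ q ∷ k ∷ []) ⟩
    v + (d + k) * q    ≡⟨ cong (λ x → v + x * q) d+k≡p ⟩
    v + p * q          ≡⟨ cong (v +_) (*-comm p q) ⟩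
    v + q * p          ≡⟨ cong (v +_) n+2≡q*p ⟨
    v + (n + 2)        ∎
    where open ≡-Reasoning

  -- An edge v ≡ u + qk − 1 that wraps around once is the jump from v to u with K = p − k.
  wrap : ∀ {u v d k} → d + k ≡ p → u + q * k ≡ v + n + 1 → u + 1 ≡ v + d * q
  wrap {u} {v} {d} {k} d+k≡p e = +-cancelʳ-≡ (q * k) _ _ (begin
    u + 1 + q * k      ≡⟨ solve (u ∷ q ∷ k ∷ []) ⟩
    u + q * k + 1      ≡⟨ cong (_+ 1) e ⟩
    v + n + 1 + 1      ≡⟨ +-assoc (v + n) 1 1 ⟩
    v + n + 2          ≡⟨ +-assoc v n 2 ⟩
    v + (n + 2)        ≡⟨ wrap-sum d+k≡p ⟨
    v + d * q + q * k  ∎)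
    where open ≡-Reasoning

  unwrap : ∀ {u v d k} → d + k ≡ p → u + 1 ≡ v + d * q → u + q * k ≡ v + n + 1
  unwrap {u} {v} {d} {k} d+k≡p e = +-cancelʳ-≡ 1 _ _ (begin
    u + q * k + 1      ≡⟨ solve (u ∷ q ∷ k ∷ []) ⟩
    u + 1 + q * k      ≡⟨ cong (_+ q * k) e ⟩
    v + d * q + q * k  ≡⟨ wrap-sum d+k≡p ⟩
    v + (n + 2)        ≡⟨ +-assoc v n 2 ⟨
    v + n + 2          ≡⟨ +-assoc (v + n) 1 1 ⟨
    v + n + 1 + 1      ∎)
    where open ≡-Reasoning

  adj⇒jumpEdge : ∀ {u v} → u + 1 < n → v + 1 < n → Adjℕ q p u v → JumpEdge q u v
  adj⇒jumpEdge {u} u+1<n v+1<n (inj₁ c) =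
    inj₁ (0 , trans (CongMod-<⇒≡ v+1<n (m+1<n⇒m<n u+1<n) c) (sym (+-identityʳ u)))
  adj⇒jumpEdge {v = v} u+1<n v+1<n (inj₂ (inj₁ c)) =
    inj₂ (0 , trans (sym (CongMod-<⇒≡ (m+1<n⇒m<n v+1<n) u+1<n c)) (sym (+-identityʳ v)))
  adj⇒jumpEdge {u} {v} u+1<n v+1<n (inj₂ (inj₂ (k , 1≤k , k≤p∸1 , c))) =
    long-edge (CongMod-<⇒≡⊎≡+ (m+1<n⇒m<n v+1<n) w<n+n c)
    where
    k<p : k < p
    k<p = subst (_≤ p) (+-comm k 1) (m≤o∸n⇒m+n≤o k 1≤p k≤p∸1)
    w : ℕ
    w = u + q * k ∸ 1
    w+1 : w + 1 ≡ u + q * k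
    w+1 = m∸n+n≡m (≤-trans (*-mono-≤ (≤-trans (s≤s z≤n) 3≤q) 1≤k) (m≤n+m (q * k) u))
    w<n+n : w < n + n
    w<n+n = <-trans (subst (w <_) w+1 (m<m+n w (s≤s z≤n))) (+-mono-< (m+1<n⇒m<n u+1<n) (q*k<n k<p))
    long-edge : v ≡ w ⊎ w ≡ v + n → JumpEdge q u v
    long-edge (inj₁ v≡w) = inj₁ (k , trans (cong (_+ 1) v≡w) (trans w+1 (cong (u +_) (*-comm q k))))
    long-edge (inj₂ w≡v+n) =
      inj₂ (p ∸ k , wrap (m∸n+n≡m (<⇒≤ k<p)) (trans (sym w+1) (cong (_+ 1) w≡v+n)))

  jump⇒adj : ∀ {u v} → v + 1 < n → Jump q u v → Adjℕ q p u v × Adjℕ q p v u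
  jump⇒adj _ (zero , e) = inj₁ (0 , inj₁ e) , inj₂ (inj₁ (0 , inj₂ e))
  jump⇒adj {u} {v} v+1<n (K@(suc _) , e) =
    inj₂ (inj₂ (K , s≤s z≤n , m+n≤o⇒m≤o∸n K (subst (_≤ p) (+-comm 1 K) K<p) , 0 , inj₁ forward)) ,
    inj₂ (inj₂ (p ∸ K , m<n⇒0<n∸m K<p , ∸-monoʳ-≤ p (s≤s z≤n) , 1 , inj₂ backward))
    where
    open ≡-Reasoning
    K<p : K < p
    K<p = *-cancelʳ-< q K p (≤-<-trans (subst (K * q ≤_) (sym e) (m≤n+m (K * q) u))
                                         (<-≤-trans v+1<n n≤p*q))
      where
      n≤p*q : n ≤ p * q
      n≤p*q = subst (n ≤_) (*-comm q p) (m∸n≤m (q * p) 2)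
    forward : v ≡ u + q * K ∸ 1 + 0 * n
    forward = begin
      v                   ≡⟨ m+n∸n≡m v 1 ⟨
      v + 1 ∸ 1           ≡⟨ cong (_∸ 1) e ⟩
      u + K * q ∸ 1       ≡⟨ cong (λ x → u + x ∸ 1) (*-comm K q) ⟩
      u + q * K ∸ 1       ≡⟨ +-identityʳ _ ⟨
      u + q * K ∸ 1 + 0   ∎
    backward : v + q * (p ∸ K) ∸ 1 ≡ u + 1 * n
    backward = begin
      v + q * (p ∸ K) ∸ 1 ≡⟨ cong (_∸ 1) (unwrap {v} {u} (m+[n∸m]≡n (<⇒≤ K<p)) e) ⟩
      u + n + 1 ∸ 1       ≡⟨ m+n∸n≡m (u + n) 1 ⟩
      u + n               ≡⟨ cong (u +_) (+-identityʳ n) ⟨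
      u + 1 * n           ∎

  jumpEdge⇒adj : ∀ {u v} → u + 1 < n → v + 1 < n → JumpEdge q u v → Adjℕ q p u v
  jumpEdge⇒adj _ v+1<n (inj₁ j) = proj₁ (jump⇒adj v+1<n j)
  jumpEdge⇒adj u+1<n _ (inj₂ j) = proj₂ (jump⇒adj u+1<n j)

  <2q²⇒+1<n : 2 * q + 1 ≤ p → ∀ {x} → x < (q + q) * q → x + 1 < n
  <2q²⇒+1<n 2q+1≤p {x} x<2q² = +-cancelʳ-≤ 2 _ _ (begin
    suc (x + 1) + 2   ≡⟨ solve (x ∷ []) ⟩
    suc x + 3         ≤⟨ +-monoˡ-≤ 3 x<2q² ⟩
    (q + q) * q + 3   ≤⟨ +-monoʳ-≤ ((q + q) * q) 3≤q ⟩
    (q + q) * q + q   ≡⟨ solve (q ∷ []) ⟩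
    q * (2 * q + 1)   ≤⟨ *-monoʳ-≤ q 2q+1≤p ⟩
    q * p             ≡⟨ n+2≡q*p ⟨
    n + 2             ∎)
    where open ≤-Reasoning

module Path (Q : ℕ) where

  q : ℕ
  q = 2 + Q

  data Label : Set where
    origin : Label
    A B C : ℕ → Label

  Valid : Label → Set
  Valid origin = ⊤
  Valid (A j) = j ≤ Q
  Valid (B j) = j ≤ Q
  Valid (C j) = j < Q

  hi lo : Label → ℕ
  hi origin = 0
  hi (A j) = suc j
  hi (B j) = q + suc j
  hi (C j) = q + suc (suc j)
  lo origin = 0
  lo (A j) = suc j
  lo (B j) = j
  lo (C j) = j

  vertex : Label → ℕ
  vertex L = hi L * q + lo L

  lo<q : ∀ L → Valid L → lo L < q
  lo<q origin _ = s≤s z≤n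
  lo<q (A j) j≤Q = s≤s (s≤s j≤Q)
  lo<q (B j) j≤Q = s≤s (m≤n⇒m≤1+n j≤Q)
  lo<q (C j) j<Q = s≤s (m≤n⇒m≤1+n (<⇒≤ j<Q))

  hi<2q : ∀ L → Valid L → hi L < q + q
  hi<2q origin _ = s≤s z≤n
  hi<2q (A j) j≤Q = ≤-trans (s≤s (s≤s j≤Q)) (m≤m+n q q)
  hi<2q (B j) j≤Q = +-monoʳ-< q (s≤s (s≤s j≤Q))
  hi<2q (C j) j<Q = +-monoʳ-< q (s≤s (s≤s j<Q))

  vertex<2q² : ∀ {L} → Valid L → vertex L < (q + q) * q
  vertex<2q² {L} v = digits-< (lo<q L v) (hi<2q L v)

  q+x≰hi-A : ∀ {j x} → j ≤ Q → q + x ≰ suc j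
  q+x≰hi-A j≤Q le = 1+n≰n (≤-trans (s≤s⁻¹ (m+n≤o⇒m≤o q le)) j≤Q)

  vertex-injective : ∀ {L L′} → Valid L → Valid L′ → vertex L ≡ vertex L′ → L ≡ L′
  vertex-injective {L} {L′} v v′ e =
    same-digits L L′ v v′ (digits-injective (lo<q L v) (lo<q L′ v′) e)
    where
    same-digits : ∀ L L′ → Valid L → Valid L′ → hi L ≡ hi L′ × lo L ≡ lo L′ → L ≡ L′
    same-digits origin origin _ _ _ = refl
    same-digits (A j) (A .j) _ _ (refl , _) = refl
    same-digits (B j) (B .j) _ _ (_ , refl) = refl
    same-digits (C j) (C .j) _ _ (_ , refl) = refl
    same-digits (A j) (B _) j≤Q _ (hi≡ , _) = ⊥-elim (q+x≰hi-A j≤Q (≤-reflexive (sym hi≡)))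
    same-digits (A j) (C _) j≤Q _ (hi≡ , _) = ⊥-elim (q+x≰hi-A j≤Q (≤-reflexive (sym hi≡)))
    same-digits (B _) (A j) _ j≤Q (hi≡ , _) = ⊥-elim (q+x≰hi-A j≤Q (≤-reflexive hi≡))
    same-digits (C _) (A j) _ j≤Q (hi≡ , _) = ⊥-elim (q+x≰hi-A j≤Q (≤-reflexive hi≡))
    same-digits (B j) (C .j) _ _ (hi≡ , refl) =
      ⊥-elim (<-irrefl (+-cancelˡ-≡ q _ _ hi≡) (n<1+n (suc j)))
    same-digits (C j) (B .j) _ _ (hi≡ , refl) =
      ⊥-elim (<-irrefl (sym (+-cancelˡ-≡ q _ _ hi≡)) (n<1+n (suc j)))
    same-digits origin (A _) _ _ (() , _)
    same-digits origin (B _) _ _ (() , _)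
    same-digits origin (C _) _ _ (() , _)
    same-digits (A _) origin _ _ (() , _)
    same-digits (B _) origin _ _ (() , _)
    same-digits (C _) origin _ _ (() , _)

  infix 4 _⟶_
  data _⟶_ : Label → Label → Set where
    origin⟶A : origin ⟶ A Q
    A⟶B : ∀ j → A j ⟶ B j
    B⟶C : ∀ j → B (suc j) ⟶ C j
    C⟶A : ∀ j → C j ⟶ A j

  Linked : Label → Label → Set
  Linked L L′ = L ⟶ L′ ⊎ L′ ⟶ L

  ⟶-valid : ∀ {L L′} → L ⟶ L′ → Valid L → Valid L′
  ⟶-valid origin⟶A _ = ≤-refl
  ⟶-valid (A⟶B j) j≤Q = j≤Q
  ⟶-valid (B⟶C j) j<Q = j<Q
  ⟶-valid (C⟶A j) j<Q = <⇒≤ j<Q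

  ⟶⇒jumpEdge : ∀ {L L′} → L ⟶ L′ → JumpEdge q (vertex L) (vertex L′)
  ⟶⇒jumpEdge origin⟶A = inj₁ (jump-carry (suc Q))
  ⟶⇒jumpEdge (A⟶B j) = inj₁ (jump-shift q (suc j) j q)
  ⟶⇒jumpEdge (B⟶C j) = inj₁ (jump-shift q (q + suc (suc j)) j 0)
  ⟶⇒jumpEdge (C⟶A j) =
    inj₂ (subst (λ h → Jump q (vertex (A j)) (h * q + j)) (sym (+-suc q (suc j)))
                (jump-shift q (suc j) j (suc q)))

  linked⇒jumpEdge : ∀ {L L′} → Linked L L′ → JumpEdge q (vertex L) (vertex L′)
  linked⇒jumpEdge (inj₁ L⟶L′) = ⟶⇒jumpEdge L⟶L′
  linked⇒jumpEdge (inj₂ L′⟶L) = swap (⟶⇒jumpEdge L′⟶L)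

  no-carry⇒linked : ∀ L L′ → Valid L → Valid L′ → lo L ≡ suc (lo L′) → hi L ≤ hi L′ → Linked L L′
  no-carry⇒linked (A j) (B .j) _ _ refl _ = inj₁ (A⟶B j)
  no-carry⇒linked (A j) (C .j) _ _ refl _ = inj₂ (C⟶A j)
  no-carry⇒linked (B _) (C j) _ _ refl _ = inj₁ (B⟶C j)
  no-carry⇒linked (A _) (A _) _ _ refl hi≤ = ⊥-elim (<-irrefl refl hi≤)
  no-carry⇒linked (B _) (B _) _ _ refl hi≤ = ⊥-elim (<-irrefl refl (+-cancelˡ-≤ q _ _ hi≤))
  no-carry⇒linked (C _) (C _) _ _ refl hi≤ = ⊥-elim (<-irrefl refl (+-cancelˡ-≤ q _ _ hi≤))
  no-carry⇒linked (C _) (B _) _ _ refl hi≤ =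
    ⊥-elim (<-irrefl refl (≤-trans (n≤1+n _) (+-cancelˡ-≤ q _ _ hi≤)))
  no-carry⇒linked (B _) (A _) _ j≤Q _ hi≤ = ⊥-elim (q+x≰hi-A j≤Q hi≤)
  no-carry⇒linked (C _) (A _) _ j≤Q _ hi≤ = ⊥-elim (q+x≰hi-A j≤Q hi≤)
  no-carry⇒linked origin _ _ _ () _
  no-carry⇒linked (A _) origin _ _ _ ()
  no-carry⇒linked (B _) origin _ _ _ ()
  no-carry⇒linked (C _) origin _ _ _ ()

  carry⇒linked : ∀ L L′ → Valid L → Valid L′ → suc (lo L′) ≡ q → lo L ≡ 0 → hi L ≤ suc (hi L′) →
                 Linked L L′
  carry⇒linked origin (A _) _ _ refl _ _ = inj₁ origin⟶A
  carry⇒linked (B _) (A _) _ _ refl refl hi≤ = ⊥-elim (m+1+n≰m q hi≤)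
  carry⇒linked (C _) (A _) _ _ refl refl hi≤ = ⊥-elim (m+1+n≰m q hi≤)
  carry⇒linked (A _) (A _) _ _ refl () _
  carry⇒linked _ (B _) _ j≤Q refl _ _ = ⊥-elim (1+n≰n j≤Q)
  carry⇒linked _ (C _) _ j<Q refl _ _ = ⊥-elim (1+n≰n (<⇒≤ j<Q))
  carry⇒linked _ origin _ _ () _ _

  jump⇒linked : ∀ {L L′} → Valid L → Valid L′ → Jump q (vertex L) (vertex L′) → Linked L L′
  jump⇒linked {L} {L′} v v′ j with jump-digits (lo<q L v) (lo<q L′ v′) j
  ... | inj₁ (lo≡ , hi≤) = no-carry⇒linked L L′ v v′ lo≡ hi≤
  ... | inj₂ (1+lo′≡q , lo≡0 , hi≤) = carry⇒linked L L′ v v′ 1+lo′≡q lo≡0 hi≤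

  jumpEdge⇒linked : ∀ {L L′} → Valid L → Valid L′ → JumpEdge q (vertex L) (vertex L′) → Linked L L′
  jumpEdge⇒linked v v′ (inj₁ j) = jump⇒linked v v′ j
  jumpEdge⇒linked v v′ (inj₂ j) = swap (jump⇒linked v′ v j)

  index : Label → ℕ
  index origin = 0
  index (A j) = 1 + 3 * (Q ∸ j)
  index (B j) = 2 + 3 * (Q ∸ j)
  index (C j) = 3 * (Q ∸ j)

  length : ℕ
  length = 3 + 3 * Q

  ⟶-index : ∀ {L L′} → L ⟶ L′ → Valid L′ → index L′ ≡ suc (index L)
  ⟶-index origin⟶A _ = cong (λ x → 1 + 3 * x) (n∸n≡0 Q)
  ⟶-index (A⟶B j) _ = refl
  ⟶-index (B⟶C j) j<Q = trans (cong (3 *_) (+-∸-assoc 1 j<Q)) (*-suc 3 (Q ∸ suc j))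
  ⟶-index (C⟶A j) _ = refl

  -- next (B 0) is a junk value: B 0 is the last vertex of the path.
  next : Label → Label
  next origin = A Q
  next (A j) = B j
  next (B zero) = origin
  next (B (suc j)) = C j
  next (C j) = A j

  ⟶-next : ∀ L → suc (index L) < length → L ⟶ next L
  ⟶-next origin _ = origin⟶A
  ⟶-next (A j) _ = A⟶B j
  ⟶-next (B zero) (s≤s (s≤s (s≤s 1+3Q≤3Q))) = ⊥-elim (1+n≰n 1+3Q≤3Q)
  ⟶-next (B (suc j)) _ = B⟶C j
  ⟶-next (C j) _ = C⟶A j

  label : ℕ → Label
  label zero = origin
  label (suc i) = next (label i)

  label-⟶ : ∀ {i} → index (label i) ≡ i → suc i < length → label i ⟶ label (suc i)
  label-⟶ {i} index≡i 1+i<length =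
    ⟶-next (label i) (subst (λ x → suc x < length) (sym index≡i) 1+i<length)

  label-valid-index : ∀ {i} → i < length → Valid (label i) × index (label i) ≡ i
  label-valid-index {zero} _ = tt , refl
  label-valid-index {suc i} 1+i<length =
    ⟶-valid step valid , trans (⟶-index step (⟶-valid step valid)) (cong suc index≡i)
    where
    valid-index : Valid (label i) × index (label i) ≡ i
    valid-index = label-valid-index (<-trans (n<1+n i) 1+i<length)
    valid : Valid (label i)
    valid = proj₁ valid-index
    index≡i : index (label i) ≡ i
    index≡i = proj₂ valid-index
    step : label i ⟶ label (suc i)
    step = label-⟶ index≡i 1+i<length

  label-valid : ∀ {i} → i < length → Valid (label i)
  label-valid i<length = proj₁ (label-valid-index i<length)

  index-label : ∀ {i} → i < length → index (label i) ≡ i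
  index-label i<length = proj₂ (label-valid-index i<length)

  label-injective : ∀ {a b} → a < length → b < length → label a ≡ label b → a ≡ b
  label-injective a<length b<length e =
    trans (sym (index-label a<length)) (trans (cong index e) (index-label b<length))

  ⟶⇒suc : ∀ {a b} → a < length → b < length → label a ⟶ label b → suc a ≡ b
  ⟶⇒suc a<length b<length a⟶b =
    trans (cong suc (sym (index-label a<length)))
          (trans (sym (⟶-index a⟶b (label-valid b<length))) (index-label b<length))

  consecutive⇒linked : ∀ {a b} → a < length → b < length →
                       Consecutive a b → Linked (label a) (label b)
  consecutive⇒linked a<length b<length (inj₁ refl) = inj₁ (label-⟶ (index-label a<length) b<length)
  consecutive⇒linked a<length b<length (inj₂ refl) = inj₂ (label-⟶ (index-label b<length) a<length)

  linked⇒consecutive : ∀ {a b} → a < length → b < length →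
                       Linked (label a) (label b) → Consecutive a b
  linked⇒consecutive a<length b<length =
    Sum.map (⟶⇒suc a<length b<length) (⟶⇒suc b<length a<length)

induced-path : ∀ {n t} (E : ℕ → ℕ → Set) (f : ℕ → ℕ) →
  (∀ {a} → a < t → f a < n) →
  (∀ {a b} → a < t → b < t → f a ≡ f b → a ≡ b) →
  (∀ {a b} → a < t → b < t → Consecutive a b → E (f a) (f b)) →
  (∀ {a b} → a < t → b < t → E (f a) (f b) → Consecutive a b) →
  HasInducedPath {Fin n} (λ i j → E (toℕ i) (toℕ j)) t
induced-path {n} {t} E f f<n f-injective consecutive⇒E E⇒consecutive =
  g , g-injective , λ a b →
    (λ c → subst₂ E (sym (toℕ-g a)) (sym (toℕ-g b)) (consecutive⇒E (toℕ<n a) (toℕ<n b) c)) ,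
    (λ e → E⇒consecutive (toℕ<n a) (toℕ<n b) (subst₂ E (toℕ-g a) (toℕ-g b) e))
  where
  g : Fin t → Fin n
  g a = fromℕ< (f<n (toℕ<n a))
  toℕ-g : ∀ a → toℕ (g a) ≡ f (toℕ a)
  toℕ-g a = toℕ-fromℕ< (f<n (toℕ<n a))
  g-injective : Injective _≡_ _≡_ g
  g-injective {a} {b} e = toℕ-injective
    (f-injective (toℕ<n a) (toℕ<n b) (trans (sym (toℕ-g a)) (trans (cong toℕ e) (toℕ-g b))))

-- The construction does not use that q is odd.
lemma8 : (q p : ℕ) → ∃[ m ] (q ≡ 2 * m + 1) → 3 ≤ q → 2 * q + 1 ≤ p →
    HasInducedPath (Adj q p) (3 * q ∸ 3)
lemma8 1 _ _ (s≤s ()) _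
lemma8 (suc (suc Q)) p _ 3≤q 2q+1≤p =
  subst (HasInducedPath (Adj (2 + Q) p)) (sym 3q∸3≡length)
    (induced-path (Adjℕ (2 + Q) p) (vertex ∘ label) (m+1<n⇒m<n ∘ near) injective
      (λ a< b< → jumpEdge⇒adj (near a<) (near b<) ∘ linked⇒jumpEdge ∘ consecutive⇒linked a< b<)
      (λ a< b< → linked⇒consecutive a< b< ∘ jumpEdge⇒linked (label-valid a<) (label-valid b<)
                   ∘ adj⇒jumpEdge (near a<) (near b<)))
  where
  open Path Q
  open Adjacency (2 + Q) p 3≤q (≤-trans (s≤s z≤n) 2q+1≤p)
  near : ∀ {a} → a < length → vertex (label a) + 1 < n
  near a<length = <2q²⇒+1<n 2q+1≤p (vertex<2q² (label-valid a<length))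
  injective : ∀ {a b} → a < length → b < length → vertex (label a) ≡ vertex (label b) → a ≡ b
  injective a<length b<length = label-injective a<length b<length
                              ∘ vertex-injective (label-valid a<length) (label-valid b<length)
  3q∸3≡length : 3 * (2 + Q) ∸ 3 ≡ length
  3q∸3≡length = trans (cong (_∸ 3) 3q≡3+length) (m+n∸m≡n 3 length)
    where
    3q≡3+length : 3 * (2 + Q) ≡ 3 + (3 + 3 * Q)
    3q≡3+length = solve (Q ∷ [])
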